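{- Let $p\geqslant 2$ be an integer and let $\varphi$ be a sentence in the language $\{0,S,+,V_p\}$. Then there is a quantifier-free sentence $\theta$ such that $\mathsf{T_{BA}}_p\vdash\varphi\leftrightarrow\theta$.
   Context: Fix an integer $p \geqslant 2$. The language consists of a constant $0$, a unary function symbol $S$, a binary function symbol $+$ and a unary function symbol $V_p$. In the standard model $(\mathbb N, S, +, 0, V_p)$, $S(n)=n+1$, $+$ is addition, $V_p(0)=0$ and, for $n>0$, $V_p(n)=p^k$ where $p^k \mid n$ and $p^{k+1}\nmid n$. For $n\in\mathbb N$, $\underline n$ denotes the numeral $S^n(0)$; for a positive integer $n$ and a term $t$, $n t$ denotes the term $(\dots((t+t)+t)\dots)$ with $n$ occurrences of $t$. Iterated exponentials are defined by $2^k_0=k$, $2^k_{m+1}=2^{2^k_m}$. For a formula $\varphi$, $|\varphi|$ is its length (number of symbols). $x \leqslant y$ abbreviates $\exists z\,(x+z=y)$ for a fresh variable $z$, and $\exists x \leqslant t\, \varphi$ abbreviates $\exists x\,(x\leqslant t \wedge \varphi)$. The theory $\mathsf{T_{BA}}_p$ consists of the (universal closures of the) axioms: (S0) $Sx=Sy\to x=y$; (S1) $0\ne Sx$; (S2) $x=0\vee\exists y\,(x=Sy)$; (A0) $x+0=x$; (A1) $x+Sy=S(x+y)$; (V0) $V_p(0)=0$; (V1) $V_p(\underline 1)=\underline 1$; (V2) $V_p(p x)=p V_p(x)$; (V3) $\bigwedge_{i=1}^{p-1} V_p(p x+\underline i)=\underline 1$; and, for each formula $\varphi(x)$ with exactly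 one free variable, (Bound$_\varphi$) $\exists x\,\varphi(x)\to\exists x\leqslant \underline{n_\varphi}\,\varphi(x)$, where $n_\varphi=p^{2^3_{|\varphi|}}$. -}

module Defs where

open import Data.Nat using (ℕ; zero; suc; _+_; _∸_; _^_)
open import Data.Fin using (Fin; zero; suc)

-- Syntax of the language {0, S, +, V_p}, de Bruijn style:
-- Term n / Formula n have their free variables among Fin n.

infixl 7 _`+_
infix  5 _≐_
infixr 4 _∧_ _∨_
infixr 3 _⇒_ _⇔_

data Term (n : ℕ) : Set where
  var  : Fin n → Term n
  `0   : Term n
  `S   : Term n → Term n
  _`+_ : Term n → Term n → Term n
  `V   : Term n → Term n

data Formula (n : ℕ) : Set where
  _≐_  : Term n → Term n → Formula n
  `¬   : Formula n → Formula n
  _∧_  : Formula n → Formula n → Formula n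
  _∨_  : Formula n → Formula n → Formula n
  _⇒_  : Formula n → Formula n → Formula n
  `∀   : Formula (suc n) → Formula n
  `∃   : Formula (suc n) → Formula n

Sentence : Set
Sentence = Formula 0

_⇔_ : ∀ {n} → Formula n → Formula n → Formula n
φ ⇔ ψ = (φ ⇒ ψ) ∧ (ψ ⇒ φ)

data QF {n : ℕ} : Formula n → Set where
  qf-eq  : ∀ {t u} → QF (t ≐ u)
  qf-not : ∀ {φ} → QF φ → QF (`¬ φ)
  qf-and : ∀ {φ ψ} → QF φ → QF ψ → QF (φ ∧ ψ)
  qf-or  : ∀ {φ ψ} → QF φ → QF ψ → QF (φ ∨ ψ)
  qf-imp : ∀ {φ ψ} → QF φ → QF ψ → QF (φ ⇒ ψ)

ext : ∀ {n m} → (Fin n → Fin m) → Fin (suc n) → Fin (suc m)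
ext ρ zero    = zero
ext ρ (suc i) = suc (ρ i)

renT : ∀ {n m} → (Fin n → Fin m) → Term n → Term m
renT ρ (var i)  = var (ρ i)
renT ρ `0       = `0
renT ρ (`S t)   = `S (renT ρ t)
renT ρ (t `+ u) = renT ρ t `+ renT ρ u
renT ρ (`V t)   = `V (renT ρ t)

renF : ∀ {n m} → (Fin n → Fin m) → Formula n → Formula m
renF ρ (t ≐ u) = renT ρ t ≐ renT ρ u
renF ρ (`¬ φ)  = `¬ (renF ρ φ)
renF ρ (φ ∧ ψ) = renF ρ φ ∧ renF ρ ψ
renF ρ (φ ∨ ψ) = renF ρ φ ∨ renF ρ ψ
renF ρ (φ ⇒ ψ) = renF ρ φ ⇒ renF ρ ψ
renF ρ (`∀ φ)  = `∀ (renF (ext ρ) φ)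
renF ρ (`∃ φ)  = `∃ (renF (ext ρ) φ)

exts : ∀ {n m} → (Fin n → Term m) → Fin (suc n) → Term (suc m)
exts σ zero    = var zero
exts σ (suc i) = renT suc (σ i)

subT : ∀ {n m} → (Fin n → Term m) → Term n → Term m
subT σ (var i)  = σ i
subT σ `0       = `0
subT σ (`S t)   = `S (subT σ t)
subT σ (t `+ u) = subT σ t `+ subT σ u
subT σ (`V t)   = `V (subT σ t)

subF : ∀ {n m} → (Fin n → Term m) → Formula n → Formula m
subF σ (t ≐ u) = subT σ t ≐ subT σ u
subF σ (`¬ φ)  = `¬ (subF σ φ)
subF σ (φ ∧ ψ) = subF σ φ ∧ subF σ ψ
subF σ (φ ∨ ψ) = subF σ φ ∨ subF σ ψ
subF σ (φ ⇒ ψ) = subF σ φ ⇒ subF σ ψ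
subF σ (`∀ φ)  = `∀ (subF (exts σ) φ)
subF σ (`∃ φ)  = `∃ (subF (exts σ) φ)

wk : ∀ {n} → Formula n → Formula (suc n)
wk = renF suc

_[_] : ∀ {n} → Formula (suc n) → Term n → Formula n
φ [ t ] = subF σ φ
  where
  σ : Fin (suc _) → Term _
  σ zero    = t
  σ (suc i) = var i

closedF : ∀ {n} → Formula 0 → Formula n
closedF = renF (λ ())

data OccT {n : ℕ} (i : Fin n) : Term n → Set where
  o-var  : OccT i (var i)
  o-S    : ∀ {t} → OccT i t → OccT i (`S t)
  o-+l   : ∀ {t u} → OccT i t → OccT i (t `+ u)
  o-+r   : ∀ {t u} → OccT i u → OccT i (t `+ u)
  o-V    : ∀ {t} → OccT i t → OccT i (`V t)

data OccF {n : ℕ} (i : Fin n) : Formula n → Set where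
  o-eql : ∀ {t u} → OccT i t → OccF i (t ≐ u)
  o-eqr : ∀ {t u} → OccT i u → OccF i (t ≐ u)
  o-not : ∀ {φ} → OccF i φ → OccF i (`¬ φ)
  o-andl : ∀ {φ ψ} → OccF i φ → OccF i (φ ∧ ψ)
  o-andr : ∀ {φ ψ} → OccF i ψ → OccF i (φ ∧ ψ)
  o-orl  : ∀ {φ ψ} → OccF i φ → OccF i (φ ∨ ψ)
  o-orr  : ∀ {φ ψ} → OccF i ψ → OccF i (φ ∨ ψ)
  o-impl : ∀ {φ ψ} → OccF i φ → OccF i (φ ⇒ ψ)
  o-impr : ∀ {φ ψ} → OccF i ψ → OccF i (φ ⇒ ψ)
  o-all  : ∀ {φ} → OccF (suc i) φ → OccF i (`∀ φ)
  o-ex   : ∀ {φ} → OccF (suc i) φ → OccF i (`∃ φ)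

-- Length (number of symbols), written with named variables:
--   variable, 0 : 1;  S t : 1+|t|;  (t+u) : 3+|t|+|u|;  V_p(t) : 3+|t|;
--   t=u : |t|+1+|u|;  ¬φ : 1+|φ|;  (φ∘ψ) : 3+|φ|+|ψ| for ∘ ∈ {∧,∨,→};
--   ∀x φ, ∃x φ : 2+|φ|.

lenT : ∀ {n} → Term n → ℕ
lenT (var i)  = 1
lenT `0       = 1
lenT (`S t)   = suc (lenT t)
lenT (t `+ u) = 3 + lenT t + lenT u
lenT (`V t)   = 3 + lenT t

len : ∀ {n} → Formula n → ℕ
len (t ≐ u) = lenT t + 1 + lenT u
len (`¬ φ)  = 1 + len φ
len (φ ∧ ψ) = 3 + len φ + len ψ
len (φ ∨ ψ) = 3 + len φ + len ψ
len (φ ⇒ ψ) = 3 + len φ + len ψ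
len (`∀ φ)  = 2 + len φ
len (`∃ φ)  = 2 + len φ

num : ∀ {n} → ℕ → Term n
num zero    = `0
num (suc k) = `S (num k)

-- (suc k) t = (…((t+t)+t)…) with suc k occurrences of t
times₁ : ∀ {n} → ℕ → Term n → Term n
times₁ zero    t = t
times₁ (suc k) t = times₁ k t `+ t

-- k t for k ≥ 1 (only used with k = p ≥ 2)
times : ∀ {n} → ℕ → Term n → Term n
times k t = times₁ (k ∸ 1) t

_≼_ : ∀ {n} → Term n → Term n → Formula n
s ≼ t = `∃ (renT suc s `+ var zero ≐ renT suc t)

∃≤ : ∀ {n} → Term n → Formula (suc n) → Formula n
∃≤ t φ = `∃ ((var zero ≼ renT suc t) ∧ φ)

tower : ℕ → ℕ → ℕ
tower k zero    = k
tower k (suc m) = 2 ^ tower k m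

-- ⋀_{i=1}^{k} f i, parenthesised to the left  (k ≥ 1 in all uses)
bigAnd : ∀ {n} → ℕ → (ℕ → Formula n) → Formula n
bigAnd zero          f = `0 ≐ `0
bigAnd (suc zero)    f = f 1
bigAnd (suc (suc k)) f = bigAnd (suc k) f ∧ f (suc (suc k))

∀₁ : Formula 1 → Formula 0
∀₁ φ = `∀ φ

∀₂ : Formula 2 → Formula 0
∀₂ φ = `∀ (`∀ φ)

x₀ x₁ : Term 2
x₀ = var zero
x₁ = var (suc zero)

data TBA (p : ℕ) : Sentence → Set where
  S0 : TBA p (∀₂ (`S x₁ ≐ `S x₀ ⇒ x₁ ≐ x₀))
  S1 : TBA p (∀₁ (`¬ (`0 ≐ `S (var zero))))
  S2 : TBA p (∀₁ ((var zero ≐ `0) ∨ `∃ (var (suc zero) ≐ `S (var zero))))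
  A0 : TBA p (∀₁ (var zero `+ `0 ≐ var zero))
  A1 : TBA p (∀₂ (x₁ `+ `S x₀ ≐ `S (x₁ `+ x₀)))
  V0 : TBA p (`V `0 ≐ `0)
  V1 : TBA p (`V (num 1) ≐ num 1)
  V2 : TBA p (∀₁ (`V (times p (var zero)) ≐ times p (`V (var zero))))
  V3 : TBA p (∀₁ (bigAnd (p ∸ 1) (λ i → `V (times p (var zero) `+ num i) ≐ num 1)))
  Bound : (φ : Formula 1) → OccF zero φ →
          TBA p (`∃ φ ⇒ ∃≤ (num (p ^ tower 3 (len φ))) φ)

-- Classical first-order Hilbert calculus with equality (Kleene's system).
-- T ⊢ φ for φ : Formula n means φ is derivable from T, with free
-- variables read as arbitrary (generalisation via the quantifier rules).

infix 2 _⊢_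

data _⊢_ (T : Sentence → Set) : ∀ {n} → Formula n → Set where
  ax    : ∀ {n φ} → T φ → T ⊢ closedF {n} φ
  mp    : ∀ {n} {φ ψ : Formula n} → T ⊢ φ ⇒ ψ → T ⊢ φ → T ⊢ ψ
  k1    : ∀ {n} {φ ψ : Formula n} → T ⊢ φ ⇒ (ψ ⇒ φ)
  k2    : ∀ {n} {φ ψ χ : Formula n} →
          T ⊢ (φ ⇒ ψ) ⇒ ((φ ⇒ (ψ ⇒ χ)) ⇒ (φ ⇒ χ))
  and-i : ∀ {n} {φ ψ : Formula n} → T ⊢ φ ⇒ (ψ ⇒ (φ ∧ ψ))
  and-l : ∀ {n} {φ ψ : Formula n} → T ⊢ (φ ∧ ψ) ⇒ φ
  and-r : ∀ {n} {φ ψ : Formula n} → T ⊢ (φ ∧ ψ) ⇒ ψ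
  or-l  : ∀ {n} {φ ψ : Formula n} → T ⊢ φ ⇒ (φ ∨ ψ)
  or-r  : ∀ {n} {φ ψ : Formula n} → T ⊢ ψ ⇒ (φ ∨ ψ)
  or-e  : ∀ {n} {φ ψ χ : Formula n} →
          T ⊢ (φ ⇒ χ) ⇒ ((ψ ⇒ χ) ⇒ ((φ ∨ ψ) ⇒ χ))
  not-i : ∀ {n} {φ ψ : Formula n} →
          T ⊢ (φ ⇒ ψ) ⇒ ((φ ⇒ `¬ ψ) ⇒ `¬ φ)
  dne   : ∀ {n} {φ : Formula n} → T ⊢ `¬ (`¬ φ) ⇒ φ
  all-e : ∀ {n} {φ : Formula (suc n)} (t : Term n) → T ⊢ `∀ φ ⇒ (φ [ t ])
  ex-i  : ∀ {n} {φ : Formula (suc n)} (t : Term n) → T ⊢ (φ [ t ]) ⇒ `∃ φ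
  all-r : ∀ {n} {ψ : Formula n} {φ : Formula (suc n)} →
          T ⊢ wk ψ ⇒ φ → T ⊢ ψ ⇒ `∀ φ
  ex-r  : ∀ {n} {ψ : Formula n} {φ : Formula (suc n)} →
          T ⊢ φ ⇒ wk ψ → T ⊢ `∃ φ ⇒ ψ
  eq-refl : ∀ {n} (t : Term n) → T ⊢ t ≐ t
  eq-sub  : ∀ {n} (φ : Formula (suc n)) (t u : Term n) →
            T ⊢ (t ≐ u) ⇒ ((φ [ t ]) ⇒ (φ [ u ]))

{-# OPTIONS --safe #-}
-- The Bound scheme turns an existential sentence ∃x χ(x) into ∃x ≤ N χ(x), and the axioms of
-- successor and addition prove x + z = N → x = 0 ∨ … ∨ x = N.  Hence ∃x χ(x) is equivalent to the
-- finite disjunction χ(0) ∨ … ∨ χ(N) of sentences with one quantifier less, and ∀ reduces to ∃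
-- classically.  Recursing on the formula while closing its free variables by numerals eliminates
-- every quantifier.
module Submission where

open import Defs
open import Data.Nat using (ℕ; zero; suc; _≤_; _≤′_; ≤′-refl; ≤′-step; _^_)
open import Data.Fin using (Fin; zero; suc)
open import Data.Product using (Σ; _×_; _,_)
open import Data.Vec.Functional using (Vector; []; _∷_)
open import Function using (_∘_)
open import Relation.Binary.PropositionalEquality
  using (_≡_; _≗_; refl; sym; trans; cong; cong₂; subst; subst₂)

private
  variable
    n : ℕ
    T : Sentence → Set
    A A′ B B′ C H : Formula n
    ρ : Fin _ → Fin _
    σ σ′ τ υ : Fin _ → Term _

renT-as-subT : var ∘ ρ ≗ σ → ∀ t → renT ρ t ≡ subT σ t
renT-as-subT e (var i)  = e i
renT-as-subT e `0       = refl
renT-as-subT e (`S t)   = cong `S (renT-as-subT e t)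
renT-as-subT e (t `+ u) = cong₂ _`+_ (renT-as-subT e t) (renT-as-subT e u)
renT-as-subT e (`V t)   = cong `V (renT-as-subT e t)

subT-subT : subT σ ∘ τ ≗ υ → ∀ t → subT σ (subT τ t) ≡ subT υ t
subT-subT e (var i)  = e i
subT-subT e `0       = refl
subT-subT e (`S t)   = cong `S (subT-subT e t)
subT-subT e (t `+ u) = cong₂ _`+_ (subT-subT e t) (subT-subT e u)
subT-subT e (`V t)   = cong `V (subT-subT e t)

subT-id : σ ≗ var → ∀ t → subT σ t ≡ t
subT-id e (var i)  = e i
subT-id e `0       = refl
subT-id e (`S t)   = cong `S (subT-id e t)
subT-id e (t `+ u) = cong₂ _`+_ (subT-id e t) (subT-id e u)
subT-id e (`V t)   = cong `V (subT-id e t)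

subT-exts-renT-suc : ∀ t → subT (exts σ) (renT suc t) ≡ renT suc (subT σ t)
subT-exts-renT-suc (var i)  = refl
subT-exts-renT-suc `0       = refl
subT-exts-renT-suc (`S t)   = cong `S (subT-exts-renT-suc t)
subT-exts-renT-suc (t `+ u) = cong₂ _`+_ (subT-exts-renT-suc t) (subT-exts-renT-suc u)
subT-exts-renT-suc (`V t)   = cong `V (subT-exts-renT-suc t)

subT-renT : σ ∘ ρ ≗ τ → ∀ t → subT σ (renT ρ t) ≡ subT τ t
subT-renT {σ = σ} e t = trans (cong (subT σ) (renT-as-subT (λ _ → refl) t)) (subT-subT e t)

subT-∷-renT-suc : ∀ (t : Term n) s → subT (t ∷ var) (renT suc s) ≡ s
subT-∷-renT-suc t s = trans (subT-renT {τ = var} (λ _ → refl) s) (subT-id (λ _ → refl) s)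

renT-num : ∀ k → renT {n} ρ (num k) ≡ num k
renT-num zero    = refl
renT-num (suc k) = cong `S (renT-num k)

var-ext-as-exts : var ∘ ρ ≗ σ → var ∘ ext ρ ≗ exts σ
var-ext-as-exts e zero    = refl
var-ext-as-exts e (suc i) = cong (renT suc) (e i)

renF-as-subF : var ∘ ρ ≗ σ → ∀ (φ : Formula n) → renF ρ φ ≡ subF σ φ
renF-as-subF e (t ≐ u) = cong₂ _≐_ (renT-as-subT e t) (renT-as-subT e u)
renF-as-subF e (`¬ φ)  = cong `¬ (renF-as-subF e φ)
renF-as-subF e (φ ∧ ψ) = cong₂ _∧_ (renF-as-subF e φ) (renF-as-subF e ψ)
renF-as-subF e (φ ∨ ψ) = cong₂ _∨_ (renF-as-subF e φ) (renF-as-subF e ψ)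
renF-as-subF e (φ ⇒ ψ) = cong₂ _⇒_ (renF-as-subF e φ) (renF-as-subF e ψ)
renF-as-subF e (`∀ φ)  = cong `∀ (renF-as-subF (var-ext-as-exts e) φ)
renF-as-subF e (`∃ φ)  = cong `∃ (renF-as-subF (var-ext-as-exts e) φ)

exts-subT : subT σ ∘ τ ≗ υ → subT (exts σ) ∘ exts τ ≗ exts υ
exts-subT e zero    = refl
exts-subT {τ = τ} e (suc i) = trans (subT-exts-renT-suc (τ i)) (cong (renT suc) (e i))

subF-subF : subT σ ∘ τ ≗ υ → ∀ (φ : Formula n) → subF σ (subF τ φ) ≡ subF υ φ
subF-subF e (t ≐ u) = cong₂ _≐_ (subT-subT e t) (subT-subT e u)
subF-subF e (`¬ φ)  = cong `¬ (subF-subF e φ)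
subF-subF e (φ ∧ ψ) = cong₂ _∧_ (subF-subF e φ) (subF-subF e ψ)
subF-subF e (φ ∨ ψ) = cong₂ _∨_ (subF-subF e φ) (subF-subF e ψ)
subF-subF e (φ ⇒ ψ) = cong₂ _⇒_ (subF-subF e φ) (subF-subF e ψ)
subF-subF e (`∀ φ)  = cong `∀ (subF-subF (exts-subT e) φ)
subF-subF e (`∃ φ)  = cong `∃ (subF-subF (exts-subT e) φ)

exts-id : σ ≗ var → exts σ ≗ var
exts-id e zero    = refl
exts-id e (suc i) = cong (renT suc) (e i)

subF-id : σ ≗ var → ∀ (φ : Formula n) → subF σ φ ≡ φ
subF-id e (t ≐ u) = cong₂ _≐_ (subT-id e t) (subT-id e u)
subF-id e (`¬ φ)  = cong `¬ (subF-id e φ)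
subF-id e (φ ∧ ψ) = cong₂ _∧_ (subF-id e φ) (subF-id e ψ)
subF-id e (φ ∨ ψ) = cong₂ _∨_ (subF-id e φ) (subF-id e ψ)
subF-id e (φ ⇒ ψ) = cong₂ _⇒_ (subF-id e φ) (subF-id e ψ)
subF-id e (`∀ φ)  = cong `∀ (subF-id (exts-id e) φ)
subF-id e (`∃ φ)  = cong `∃ (subF-id (exts-id e) φ)

subF-cong : σ ≗ σ′ → ∀ (φ : Formula n) → subF σ φ ≡ subF σ′ φ
subF-cong {σ = σ} e φ = trans (cong (subF σ) (sym (subF-id (λ _ → refl) φ))) (subF-subF e φ)

subF-renF : σ ∘ ρ ≗ υ → ∀ (φ : Formula n) → subF σ (renF ρ φ) ≡ subF υ φ
subF-renF {σ = σ} e φ = trans (cong (subF σ) (renF-as-subF (λ _ → refl) φ)) (subF-subF e φ)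

renF-subF : renT ρ ∘ σ ≗ υ → ∀ (φ : Formula n) → renF ρ (subF σ φ) ≡ subF υ φ
renF-subF {σ = σ} e φ =
  trans (renF-as-subF (λ _ → refl) (subF σ φ))
        (subF-subF (λ i → trans (sym (renT-as-subT (λ _ → refl) (σ i))) (e i)) φ)

closedF-id : (φ : Sentence) → closedF φ ≡ φ
closedF-id φ = trans (renF-as-subF {σ = var} (λ ()) φ) (subF-id (λ _ → refl) φ)

[]-as-subF : (φ : Formula (suc n)) (t : Term n) → φ [ t ] ≡ subF (t ∷ var) φ
[]-as-subF φ t = subF-cong (λ { zero → refl ; (suc i) → refl }) φ

subF-var₀-renF-ext-suc : (φ : Formula (suc n)) → subF (var zero ∷ var) (renF (ext suc) φ) ≡ φ
subF-var₀-renF-ext-suc φ =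
  trans (subF-renF {υ = var} (λ { zero → refl ; (suc i) → refl }) φ) (subF-id (λ _ → refl) φ)

subF-∷-renF-ext-suc : (φ : Formula (suc n)) (t : Term n) →
                      subF (renT suc t ∷ var) (renF (ext suc) φ) ≡ renF suc (subF (t ∷ var) φ)
subF-∷-renF-ext-suc φ t =
  trans (subF-renF {υ = renT suc t ∷ var ∘ suc} (λ { zero → refl ; (suc i) → refl }) φ)
        (sym (renF-subF (λ { zero → refl ; (suc i) → refl }) φ))

subF-∷-exts : ∀ (φ : Formula (suc n)) (t : Term 0) (ρ : Vector (Term 0) n) →
              subF (t ∷ var) (subF (exts ρ) φ) ≡ subF (t ∷ ρ) φ
subF-∷-exts φ t ρ = subF-subF (λ { zero → refl ; (suc i) → subT-∷-renT-suc t (ρ i) }) φ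

⇒-refl : T ⊢ A ⇒ A
⇒-refl {A = A} = mp (mp (k2 {ψ = A ⇒ A}) k1) k1

⇒-const : T ⊢ B → T ⊢ A ⇒ B
⇒-const = mp k1

mp-under : T ⊢ A ⇒ (B ⇒ C) → T ⊢ A ⇒ B → T ⊢ A ⇒ C
mp-under abc ab = mp (mp k2 ab) abc

mp-under₂ : T ⊢ H ⇒ (A ⇒ (B ⇒ C)) → T ⊢ H ⇒ (A ⇒ B) → T ⊢ H ⇒ (A ⇒ C)
mp-under₂ habc hab = mp-under (mp-under (⇒-const k2) hab) habc

mp-second : T ⊢ A ⇒ (B ⇒ C) → T ⊢ B → T ⊢ A ⇒ C
mp-second abc b = mp-under abc (⇒-const b)

⇒-trans : T ⊢ A ⇒ B → T ⊢ B ⇒ C → T ⊢ A ⇒ C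
⇒-trans ab bc = mp-under (⇒-const bc) ab

∧-curry : T ⊢ (A ∧ B) ⇒ C → T ⊢ A ⇒ (B ⇒ C)
∧-curry h = mp-under₂ (⇒-const (⇒-const h)) and-i

⇒-swap : T ⊢ A ⇒ (B ⇒ C) → T ⊢ B ⇒ (A ⇒ C)
⇒-swap h = ∧-curry (mp-under (⇒-trans and-r h) and-l)

contraposition : T ⊢ A ⇒ B → T ⊢ `¬ B ⇒ `¬ A
contraposition ab = mp-under (mp-under (⇒-const not-i) (⇒-const ab)) k1

¬¬-intro : T ⊢ A ⇒ `¬ (`¬ A)
¬¬-intro = mp-under (mp-under (⇒-const not-i) k1) (⇒-const ⇒-refl)

ex-falso : T ⊢ A ⇒ (`¬ A ⇒ B)
ex-falso = ∧-curry (⇒-trans (mp-under (mp-under (⇒-const not-i) (⇒-trans and-l k1))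
                                      (⇒-trans and-r k1))
                            dne)

∧-mono : T ⊢ A ⇒ A′ → T ⊢ B ⇒ B′ → T ⊢ (A ∧ B) ⇒ (A′ ∧ B′)
∧-mono f g = mp-under (mp-under (⇒-const and-i) (⇒-trans and-l f)) (⇒-trans and-r g)

∨-mono : T ⊢ A ⇒ A′ → T ⊢ B ⇒ B′ → T ⊢ (A ∨ B) ⇒ (A′ ∨ B′)
∨-mono f g = mp (mp or-e (⇒-trans f or-l)) (⇒-trans g or-r)

⇒-mono : T ⊢ A′ ⇒ A → T ⊢ B ⇒ B′ → T ⊢ (A ⇒ B) ⇒ (A′ ⇒ B′)
⇒-mono f g = mp-under₂ (⇒-const (⇒-const g)) (mp-under₂ k1 (⇒-const f))

⇒-monoʳ : T ⊢ B ⇒ B′ → T ⊢ (A ⇒ B) ⇒ (A ⇒ B′)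
⇒-monoʳ = ⇒-mono ⇒-refl

⇔-intro : T ⊢ A ⇒ B → T ⊢ B ⇒ A → T ⊢ A ⇔ B
⇔-intro f g = mp (mp and-i f) g

⇔-fwd : T ⊢ A ⇔ B → T ⊢ A ⇒ B
⇔-fwd = mp and-l

⇔-bwd : T ⊢ A ⇔ B → T ⊢ B ⇒ A
⇔-bwd = mp and-r

⇔-refl : T ⊢ A ⇔ A
⇔-refl = ⇔-intro ⇒-refl ⇒-refl

⇔-trans : T ⊢ A ⇔ B → T ⊢ B ⇔ C → T ⊢ A ⇔ C
⇔-trans f g = ⇔-intro (⇒-trans (⇔-fwd f) (⇔-fwd g)) (⇒-trans (⇔-bwd g) (⇔-bwd f))

¬-cong : T ⊢ A ⇔ B → T ⊢ `¬ A ⇔ `¬ B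
¬-cong f = ⇔-intro (contraposition (⇔-bwd f)) (contraposition (⇔-fwd f))

∧-cong : T ⊢ A ⇔ A′ → T ⊢ B ⇔ B′ → T ⊢ (A ∧ B) ⇔ (A′ ∧ B′)
∧-cong f g = ⇔-intro (∧-mono (⇔-fwd f) (⇔-fwd g)) (∧-mono (⇔-bwd f) (⇔-bwd g))

∨-cong : T ⊢ A ⇔ A′ → T ⊢ B ⇔ B′ → T ⊢ (A ∨ B) ⇔ (A′ ∨ B′)
∨-cong f g = ⇔-intro (∨-mono (⇔-fwd f) (⇔-fwd g)) (∨-mono (⇔-bwd f) (⇔-bwd g))

⇒-cong : T ⊢ A ⇔ A′ → T ⊢ B ⇔ B′ → T ⊢ (A ⇒ B) ⇔ (A′ ⇒ B′)
⇒-cong f g = ⇔-intro (⇒-mono (⇔-bwd f) (⇔-fwd g)) (⇒-mono (⇔-fwd f) (⇔-bwd g))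

all-e′ : ∀ {φ : Formula (suc n)} t → T ⊢ `∀ φ ⇒ subF (t ∷ var) φ
all-e′ {φ = φ} t = subst (λ ψ → _ ⊢ `∀ φ ⇒ ψ) ([]-as-subF φ t) (all-e t)

ex-i′ : ∀ {φ : Formula (suc n)} t → T ⊢ subF (t ∷ var) φ ⇒ `∃ φ
ex-i′ {φ = φ} t = subst (λ ψ → _ ⊢ ψ ⇒ `∃ φ) ([]-as-subF φ t) (ex-i t)

eq-sub′ : ∀ (φ : Formula (suc n)) t u → T ⊢ (t ≐ u) ⇒ (subF (t ∷ var) φ ⇒ subF (u ∷ var) φ)
eq-sub′ φ t u =
  subst₂ (λ ψ χ → _ ⊢ (t ≐ u) ⇒ (ψ ⇒ χ)) ([]-as-subF φ t) ([]-as-subF φ u) (eq-sub φ t u)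

∃-mono : T ⊢ A ⇒ B → T ⊢ `∃ A ⇒ `∃ B
∃-mono {B = B} ab =
  ex-r (⇒-trans ab (subst (λ ψ → _ ⊢ ψ ⇒ `∃ (renF (ext suc) B)) (subF-var₀-renF-ext-suc B)
                          (ex-i′ (var zero))))

∀⇔¬∃¬ : (φ : Formula (suc n)) → T ⊢ `∀ φ ⇔ `¬ (`∃ (`¬ φ))
∀⇔¬∃¬ φ = ⇔-intro (⇒-trans ¬¬-intro (contraposition ∃¬⇒¬∀))
                  (all-r (⇒-trans (contraposition ¬⇒∃¬) dne))
  where
  ∃¬⇒¬∀ : _ ⊢ `∃ (`¬ φ) ⇒ `¬ (`∀ φ)
  ∃¬⇒¬∀ = ex-r (contraposition (subst (λ ψ → _ ⊢ `∀ (renF (ext suc) φ) ⇒ ψ)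
                                      (subF-var₀-renF-ext-suc φ) (all-e′ (var zero))))
  ¬⇒∃¬ : _ ⊢ `¬ φ ⇒ `∃ (`¬ (renF (ext suc) φ))
  ¬⇒∃¬ = subst (λ ψ → _ ⊢ `¬ ψ ⇒ `∃ (`¬ (renF (ext suc) φ)))
               (subF-var₀-renF-ext-suc φ) (ex-i′ (var zero))

≐-sym : ∀ {t u : Term n} → T ⊢ (t ≐ u) ⇒ (u ≐ t)
≐-sym {t = t} {u} = mp-second (subst₂ (λ a b → _ ⊢ (t ≐ u) ⇒ ((t ≐ a) ⇒ (u ≐ b)))
                                      (subT-∷-renT-suc t t) (subT-∷-renT-suc u t)
                                      (eq-sub′ (var zero ≐ renT suc t) t u))
                              (eq-refl t)

≐-trans : ∀ {s t u : Term n} → T ⊢ (s ≐ t) ⇒ ((t ≐ u) ⇒ (s ≐ u))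
≐-trans {s = s} {t} {u} = ⇒-swap (subst₂ (λ a b → _ ⊢ (t ≐ u) ⇒ ((a ≐ t) ⇒ (b ≐ u)))
                                         (subT-∷-renT-suc t s) (subT-∷-renT-suc u s)
                                         (eq-sub′ (renT suc s ≐ var zero) t u))

≐-sym-trans : ∀ {s t u : Term n} → T ⊢ (s ≐ t) ⇒ ((s ≐ u) ⇒ (t ≐ u))
≐-sym-trans = ⇒-trans ≐-sym ≐-trans

+-congˡ : ∀ {s t u : Term n} → T ⊢ (t ≐ u) ⇒ (s `+ t ≐ s `+ u)
+-congˡ {T = T} {s = s} {t} {u} =
  mp-second (subst₂ (λ φ ψ → T ⊢ (t ≐ u) ⇒ (φ ⇒ ψ))
                    (cong₂ _≐_ (subT-∷-renT-suc t (s `+ t)) (cong (_`+ t) (subT-∷-renT-suc t s)))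
                    (cong₂ _≐_ (subT-∷-renT-suc u (s `+ t)) (cong (_`+ u) (subT-∷-renT-suc u s)))
                    (eq-sub′ (renT suc (s `+ t) ≐ renT suc s `+ var zero) t u))
            (eq-refl (s `+ t))

≐-replace : ∀ (φ : Formula (suc n)) t → T ⊢ (var zero ≐ renT suc t) ⇒ (φ ⇒ wk (subF (t ∷ var) φ))
≐-replace {T = T} φ t =
  subst₂ (λ ψ χ → T ⊢ (var zero ≐ renT suc t) ⇒ (ψ ⇒ χ))
         (subF-var₀-renF-ext-suc φ) (subF-∷-renF-ext-suc φ t)
         (eq-sub′ (renF (ext suc) φ) (var zero) (renT suc t))

⋁≤ : ℕ → (ℕ → Formula n) → Formula n
⋁≤ zero    f = f zero
⋁≤ (suc N) f = ⋁≤ N f ∨ f (suc N)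

⋁≤-intro : ∀ {f : ℕ → Formula n} {k N} → k ≤′ N → T ⊢ f k ⇒ ⋁≤ N f
⋁≤-intro {N = zero}  ≤′-refl      = ⇒-refl
⋁≤-intro {N = suc N} ≤′-refl      = or-r
⋁≤-intro             (≤′-step le) = ⇒-trans (⋁≤-intro le) or-l

⋁≤-elim : ∀ {f : ℕ → Formula n} N → (∀ k → k ≤′ N → T ⊢ f k ⇒ B) → T ⊢ ⋁≤ N f ⇒ B
⋁≤-elim zero    h = h zero ≤′-refl
⋁≤-elim (suc N) h = mp (mp or-e (⋁≤-elim N (λ k le → h k (≤′-step le)))) (h (suc N) ≤′-refl)

renF-⋁≤ : ∀ (f : ℕ → Formula n) N → renF ρ (⋁≤ N f) ≡ ⋁≤ N (renF ρ ∘ f)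
renF-⋁≤ f zero    = refl
renF-⋁≤ {ρ = ρ} f (suc N) = cong (_∨ renF ρ (f (suc N))) (renF-⋁≤ f N)

_≐num≤_ : Term n → ℕ → Formula n
x ≐num≤ N = ⋁≤ N (λ k → x ≐ num k)

renF-≐num≤ : ∀ (x : Term n) N → renF ρ (x ≐num≤ N) ≡ renT ρ x ≐num≤ N
renF-≐num≤ x zero    = refl
renF-≐num≤ {ρ = ρ} x (suc N) = cong₂ _∨_ (renF-≐num≤ x N) (cong (renT ρ x ≐_) (renT-num (suc N)))

QFEquivalent : (Sentence → Set) → Sentence → Set
QFEquivalent T φ = Σ Sentence (λ θ → QF θ × (T ⊢ φ ⇔ θ))

qfe-transport : ∀ {φ ψ} → T ⊢ φ ⇔ ψ → QFEquivalent T ψ → QFEquivalent T φ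
qfe-transport e (θ , q , e′) = θ , q , ⇔-trans e e′

qfe-¬ : ∀ {φ} → QFEquivalent T φ → QFEquivalent T (`¬ φ)
qfe-¬ (θ , q , e) = `¬ θ , qf-not q , ¬-cong e

qfe-∧ : ∀ {φ ψ} → QFEquivalent T φ → QFEquivalent T ψ → QFEquivalent T (φ ∧ ψ)
qfe-∧ (θ , q , e) (θ′ , q′ , e′) = (θ ∧ θ′) , qf-and q q′ , ∧-cong e e′

qfe-∨ : ∀ {φ ψ} → QFEquivalent T φ → QFEquivalent T ψ → QFEquivalent T (φ ∨ ψ)
qfe-∨ (θ , q , e) (θ′ , q′ , e′) = (θ ∨ θ′) , qf-or q q′ , ∨-cong e e′

qfe-⇒ : ∀ {φ ψ} → QFEquivalent T φ → QFEquivalent T ψ → QFEquivalent T (φ ⇒ ψ)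
qfe-⇒ (θ , q , e) (θ′ , q′ , e′) = (θ ⇒ θ′) , qf-imp q q′ , ⇒-cong e e′

qfe-⋁≤ : ∀ {f : ℕ → Sentence} N → (∀ k → QFEquivalent T (f k)) → QFEquivalent T (⋁≤ N f)
qfe-⋁≤ zero    h = h zero
qfe-⋁≤ (suc N) h = qfe-∨ (qfe-⋁≤ N h) (h (suc N))

module _ {p : ℕ} where

  suc-injective : ∀ (a b : Term n) → TBA p ⊢ `S a ≐ `S b ⇒ a ≐ b
  suc-injective a b = subst (λ c → _ ⊢ `S c ≐ `S b ⇒ c ≐ b) (subT-∷-renT-suc b a)
                            (mp (all-e′ b) (mp (all-e′ a) (ax S0)))

  0≢suc : ∀ (a : Term n) → TBA p ⊢ `¬ (`0 ≐ `S a)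
  0≢suc a = mp (all-e′ a) (ax S1)

  zero-or-suc : ∀ (a : Term n) → TBA p ⊢ (a ≐ `0) ∨ `∃ (renT suc a ≐ `S (var zero))
  zero-or-suc a = mp (all-e′ a) (ax S2)

  +-identityʳ : ∀ (a : Term n) → TBA p ⊢ a `+ `0 ≐ a
  +-identityʳ a = mp (all-e′ a) (ax A0)

  +-suc : ∀ (a b : Term n) → TBA p ⊢ a `+ `S b ≐ `S (a `+ b)
  +-suc a b = subst (λ c → _ ⊢ c `+ `S b ≐ `S (c `+ b)) (subT-∷-renT-suc b a)
                    (mp (all-e′ b) (mp (all-e′ a) (ax A1)))

  suc≐0-elim : ∀ (a : Term n) → TBA p ⊢ (`S a ≐ `0) ⇒ B
  suc≐0-elim a = ⇒-trans ≐-sym (mp (⇒-swap ex-falso) (0≢suc a))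

  +≐num⇒≐num≤ : ∀ N (x z : Term n) → TBA p ⊢ (x `+ z ≐ num N) ⇒ (x ≐num≤ N)
  +≐num⇒≐num≤ {n} N x z = mp (mp (mp or-e zero-case) suc-case) (zero-or-suc z)
    where
    zero-case : TBA p ⊢ (z ≐ `0) ⇒ ((x `+ z ≐ num N) ⇒ (x ≐num≤ N))
    zero-case = ⇒-trans (⇒-trans +-congˡ (mp-second ≐-trans (+-identityʳ x)))
                        (⇒-trans ≐-sym-trans (⇒-monoʳ (⋁≤-intro {f = λ k → x ≐ num k} ≤′-refl)))

    x′ z′ y : Term (suc n)
    x′ = renT suc x
    z′ = renT suc z
    y  = var zero

    suc≐num⇒ : ∀ N → TBA p ⊢ (`S (x′ `+ y) ≐ num N) ⇒ (x′ ≐num≤ N)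
    suc≐num⇒ zero    = suc≐0-elim (x′ `+ y)
    suc≐num⇒ (suc M) = ⇒-trans (suc-injective (x′ `+ y) (num M))
                               (⇒-trans (+≐num⇒≐num≤ M x′ y) or-l)

    suc-case-for-y : TBA p ⊢ (z′ ≐ `S y) ⇒ ((x′ `+ z′ ≐ num N) ⇒ (x′ ≐num≤ N))
    suc-case-for-y = ⇒-trans (⇒-trans +-congˡ (mp-second ≐-trans (+-suc x′ y)))
                             (⇒-trans ≐-sym-trans (⇒-monoʳ (suc≐num⇒ N)))

    suc-case : TBA p ⊢ `∃ (z′ ≐ `S y) ⇒ ((x `+ z ≐ num N) ⇒ (x ≐num≤ N))
    suc-case = ex-r (subst₂ (λ a φ → _ ⊢ (z′ ≐ `S y) ⇒ ((x′ `+ z′ ≐ a) ⇒ φ))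
                            (sym (renT-num N)) (sym (renF-≐num≤ x N)) suc-case-for-y)

  ≼num⇒≐num≤ : ∀ (x : Term n) N → TBA p ⊢ (x ≼ num N) ⇒ (x ≐num≤ N)
  ≼num⇒≐num≤ x N = ex-r (subst₂ (λ a φ → _ ⊢ (renT suc x `+ var zero ≐ a) ⇒ φ)
                                (sym (renT-num N)) (sym (renF-≐num≤ x N))
                                (+≐num⇒≐num≤ N (renT suc x) (var zero)))

  witnessBound : Formula 1 → ℕ
  witnessBound χ = p ^ tower 3 (len (χ ∧ (var zero ≐ var zero)))

  ∃⇔⋁≤ : (χ : Formula 1) → TBA p ⊢ `∃ χ ⇔ ⋁≤ (witnessBound χ) (λ k → subF (num k ∷ var) χ)
  ∃⇔⋁≤ χ = ⇔-intro (⇒-trans (∃-mono pad) (⇒-trans bound (ex-r bounded⇒⋁)))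
                   (⋁≤-elim N (λ k _ → ex-i′ (num k)))
    where
    N : ℕ
    N = witnessBound χ

    instances : ℕ → Sentence
    instances k = subF (num k ∷ var) χ

    -- Bound only applies when the variable occurs free, hence the padding x = x.
    χ⁺ : Formula 1
    χ⁺ = χ ∧ (var zero ≐ var zero)

    pad : TBA p ⊢ χ ⇒ χ⁺
    pad = mp-under and-i (⇒-const (eq-refl (var zero)))

    bound : TBA p ⊢ `∃ χ⁺ ⇒ ∃≤ (num N) χ⁺
    bound = subst (TBA p ⊢_) (closedF-id _) (ax (Bound χ⁺ (o-andr (o-eql o-var))))

    instance-cases : TBA p ⊢ (var zero ≐num≤ N) ⇒ (χ ⇒ ⋁≤ N (wk ∘ instances))
    instance-cases = ⋁≤-elim N λ k le →
      ⇒-trans (subst (λ a → TBA p ⊢ (var zero ≐ a) ⇒ (χ ⇒ wk (instances k)))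
                     (renT-num k) (≐-replace χ (num k)))
              (⇒-monoʳ (⋁≤-intro le))

    bounded⇒⋁ : TBA p ⊢ ((var zero ≼ renT suc (num N)) ∧ χ⁺) ⇒ wk (⋁≤ N instances)
    bounded⇒⋁ =
      subst (λ φ → TBA p ⊢ ((var zero ≼ renT suc (num N)) ∧ χ⁺) ⇒ φ) (sym (renF-⋁≤ instances N))
            (mp-under (⇒-trans and-l (⇒-trans bounded instance-cases)) (⇒-trans and-r and-l))
      where
      bounded : TBA p ⊢ (var zero ≼ renT suc (num N)) ⇒ (var zero ≐num≤ N)
      bounded = subst (λ a → TBA p ⊢ (var zero ≼ a) ⇒ (var zero ≐num≤ N))
                      (sym (renT-num N)) (≼num⇒≐num≤ (var zero) N)

  qfe-∃ : (χ : Formula 1) → (∀ k → QFEquivalent (TBA p) (subF (num k ∷ var) χ)) →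
          QFEquivalent (TBA p) (`∃ χ)
  qfe-∃ χ h = qfe-transport (∃⇔⋁≤ χ) (qfe-⋁≤ (witnessBound χ) h)

  qfe-∀ : (χ : Formula 1) → (∀ k → QFEquivalent (TBA p) (subF (num k ∷ var) χ)) →
          QFEquivalent (TBA p) (`∀ χ)
  qfe-∀ χ h = qfe-transport (∀⇔¬∃¬ χ) (qfe-¬ (qfe-∃ (`¬ χ) (λ k → qfe-¬ (h k))))

  mutual
    qfe-instance : (φ : Formula n) (ρ : Vector (Term 0) n) → QFEquivalent (TBA p) (subF ρ φ)
    qfe-instance (t ≐ u) ρ = subF ρ (t ≐ u) , qf-eq , ⇔-refl
    qfe-instance (`¬ φ)  ρ = qfe-¬ (qfe-instance φ ρ)
    qfe-instance (φ ∧ ψ) ρ = qfe-∧ (qfe-instance φ ρ) (qfe-instance ψ ρ)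
    qfe-instance (φ ∨ ψ) ρ = qfe-∨ (qfe-instance φ ρ) (qfe-instance ψ ρ)
    qfe-instance (φ ⇒ ψ) ρ = qfe-⇒ (qfe-instance φ ρ) (qfe-instance ψ ρ)
    qfe-instance (`∀ φ)  ρ = qfe-∀ (subF (exts ρ) φ) (qfe-body φ ρ)
    qfe-instance (`∃ φ)  ρ = qfe-∃ (subF (exts ρ) φ) (qfe-body φ ρ)

    qfe-body : (φ : Formula (suc n)) (ρ : Vector (Term 0) n) →
               ∀ k → QFEquivalent (TBA p) (subF (num k ∷ var) (subF (exts ρ) φ))
    qfe-body φ ρ k = subst (QFEquivalent (TBA p)) (sym (subF-∷-exts φ (num k) ρ))
                           (qfe-instance φ (num k ∷ ρ))

lemma4 : (p : ℕ) → 2 ≤ p → (φ : Sentence) →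
         Σ Sentence (λ θ → QF θ × (TBA p ⊢ φ ⇔ θ))
lemma4 p _ φ = subst (QFEquivalent (TBA p)) (subF-id (λ ()) φ) (qfe-instance φ [])
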